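{- Let $\mathcal{A}$ be a simple $\mathbf{tDL}$-algebra. Then: (a) for every $X\in\mathcal{P}(A)\setminus\{\emptyset,\{0\},\{1\}\}$ and every $a\in A$ there are $x_1,\dots,x_{n_a},y_1,\dots,y_{m_a}\in X$ and $p_a,q_a\in\omega$ such that $d^{p_a}\left(\bigwedge_{i=1}^{n_a}x_i\right)\le a\le\hat{d}^{q_a}\left(\bigvee_{j=1}^{m_a}y_j\right)$; (b) for every $a\in A\setminus\{0,1\}$ there are $p_a,q_a\in\omega$ with $d^{p_a}a=0$ and $\hat{d}^{q_a}a=1$; (c) $\mathcal{F}_t(A)=\{A,\{1\}\}$ and $\mathcal{I}_t(A)=\{A,\{0\}\}$; and (d) $A^d=\{0,1\}$.
   Context: A $\mathbf{tDL}$-algebra is a bounded distributive lattice $\langle A,\wedge,\vee,0,1\rangle$ with unary operators $\mathbf{G},\mathbf{H},\mathbf{F},\mathbf{P}$ such that for all $x,y$: $\mathbf{G}1=\mathbf{H}1=1$; $\mathbf{G},\mathbf{H}$ preserve $\wedge$; $x\le\mathbf{G}\mathbf{P}x$, $x\le\mathbf{H}\mathbf{F}x$; $\mathbf{G}(x\vee y)\le\mathbf{G}x\vee\mathbf{F}y$, $\mathbf{H}(x\vee y)\le\mathbf{H}x\vee\mathbf{P}y$; $\mathbf{F}0=\mathbf{P}0=0$; $\mathbf{F},\mathbf{P}$ preserve $\vee$; $\mathbf{P}\mathbf{G}x\le x$, $\mathbf{F}\mathbf{H}x\le x$; $\mathbf{G}x\wedge\mathbf{F}y\le\mathbf{F}(x\wedge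 y)$, $\mathbf{H}x\wedge\mathbf{P}y\le\mathbf{P}(x\wedge y)$. Simplicity refers to congruences of this algebra. Define $dx=\mathbf{G}x\wedge x\wedge\mathbf{H}x$, $\hat{d}x=\mathbf{F}x\vee x\vee\mathbf{P}x$, $d^0x=x$, $d^{n+1}x=d(d^nx)$, and similarly $\hat{d}^n$. $A^d=\{x:x=dx\}$. $\mathcal{F}_t(A)$: lattice filters closed under $\mathbf{G},\mathbf{H}$; $\mathcal{I}_t(A)$: lattice ideals closed under $\mathbf{F},\mathbf{P}$. -}

module Defs where

open import Level using (Level; suc; _⊔_)
open import Data.Nat using (ℕ; zero) renaming (suc to sucℕ)
open import Data.Product using (Σ; _×_; _,_; ∃)
open import Data.Sum using (_⊎_)
open import Data.List using (List)
open import Data.List.NonEmpty using (List⁺; foldr₁; toList)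
open import Relation.Binary.PropositionalEquality using (_≡_; _≢_)
open import Relation.Binary.Structures using (IsEquivalence)
open import Relation.Unary using (Pred)
open import Relation.Nullary using (¬_)
open import Algebra.Lattice.Structures using (IsDistributiveLattice)

record TDL (ℓ : Level) : Set (suc ℓ) where
  infixr 7 _∧_
  infixr 6 _∨_
  infix 4 _≤_
  field
    Carrier : Set ℓ
    _∧_ _∨_ : Carrier → Carrier → Carrier
    𝟘 𝟙 : Carrier
    G H F P : Carrier → Carrier
    isDistributiveLattice : IsDistributiveLattice _≡_ _∨_ _∧_
    ∨-identityˡ : ∀ x → 𝟘 ∨ x ≡ x
    ∧-identityˡ : ∀ x → 𝟙 ∧ x ≡ x

  _≤_ : Carrier → Carrier → Set ℓ
  x ≤ y = x ∧ y ≡ x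

  field
    G1 : G 𝟙 ≡ 𝟙
    H1 : H 𝟙 ≡ 𝟙
    G∧ : ∀ x y → G (x ∧ y) ≡ G x ∧ G y
    H∧ : ∀ x y → H (x ∧ y) ≡ H x ∧ H y
    x≤GPx : ∀ x → x ≤ G (P x)
    x≤HFx : ∀ x → x ≤ H (F x)
    G∨ : ∀ x y → G (x ∨ y) ≤ G x ∨ F y
    H∨ : ∀ x y → H (x ∨ y) ≤ H x ∨ P y
    F0 : F 𝟘 ≡ 𝟘
    P0 : P 𝟘 ≡ 𝟘
    F∨ : ∀ x y → F (x ∨ y) ≡ F x ∨ F y
    P∨ : ∀ x y → P (x ∨ y) ≡ P x ∨ P y
    PGx≤x : ∀ x → P (G x) ≤ x
    FHx≤x : ∀ x → F (H x) ≤ x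
    G∧F : ∀ x y → G x ∧ F y ≤ F (x ∧ y)
    H∧P : ∀ x y → H x ∧ P y ≤ P (x ∧ y)

  d : Carrier → Carrier
  d x = G x ∧ x ∧ H x

  d̂ : Carrier → Carrier
  d̂ x = F x ∨ x ∨ P x

  d^ : ℕ → Carrier → Carrier
  d^ zero x = x
  d^ (sucℕ n) x = d (d^ n x)

  d̂^ : ℕ → Carrier → Carrier
  d̂^ zero x = x
  d̂^ (sucℕ n) x = d̂ (d̂^ n x)

  ⋀ : List⁺ Carrier → Carrier
  ⋀ = foldr₁ _∧_

  ⋁ : List⁺ Carrier → Carrier
  ⋁ = foldr₁ _∨_

  record IsCongruence (θ : Carrier → Carrier → Set ℓ) : Set ℓ where
    field
      isEquivalence : IsEquivalence θ
      ∧-cong : ∀ {x x′ y y′} → θ x x′ → θ y y′ → θ (x ∧ y) (x′ ∧ y′)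
      ∨-cong : ∀ {x x′ y y′} → θ x x′ → θ y y′ → θ (x ∨ y) (x′ ∨ y′)
      G-cong : ∀ {x x′} → θ x x′ → θ (G x) (G x′)
      H-cong : ∀ {x x′} → θ x x′ → θ (H x) (H x′)
      F-cong : ∀ {x x′} → θ x x′ → θ (F x) (F x′)
      P-cong : ∀ {x x′} → θ x x′ → θ (P x) (P x′)

  IsSimple : Set (suc ℓ)
  IsSimple = (Σ Carrier λ x → Σ Carrier λ y → x ≢ y)
           × (∀ θ → IsCongruence θ → (∀ x y → θ x y → x ≡ y) ⊎ (∀ x y → θ x y))

  _≐_ : Pred Carrier ℓ → Pred Carrier ℓ → Set ℓ
  X ≐ Y = ∀ x → (X x → Y x) × (Y x → X x)

  ∅ₛ : Pred Carrier ℓ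
  ∅ₛ _ = Lift′
    where open import Data.Empty.Polymorphic using () renaming (⊥ to Lift′)

  Aₛ : Pred Carrier ℓ
  Aₛ _ = Lift′
    where open import Data.Unit.Polymorphic using () renaming (⊤ to Lift′)

  ｛_｝ : Carrier → Pred Carrier ℓ
  ｛ a ｝ x = x ≡ a

  record IsTFilter (Φ : Pred Carrier ℓ) : Set ℓ where
    field
      has-𝟙 : Φ 𝟙
      up-closed : ∀ {x y} → x ≤ y → Φ x → Φ y
      ∧-closed : ∀ {x y} → Φ x → Φ y → Φ (x ∧ y)
      G-closed : ∀ {x} → Φ x → Φ (G x)
      H-closed : ∀ {x} → Φ x → Φ (H x)

  record IsTIdeal (Ι : Pred Carrier ℓ) : Set ℓ where
    field
      has-𝟘 : Ι 𝟘
      down-closed : ∀ {x y} → x ≤ y → Ι y → Ι x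
      ∨-closed : ∀ {x y} → Ι x → Ι y → Ι (x ∨ y)
      F-closed : ∀ {x} → Ι x → Ι (F x)
      P-closed : ∀ {x} → Ι x → Ι (P x)

{-# OPTIONS --safe #-}
-- Fix a ≠ 𝟙 and say that x, y agree eventually if x ∧ dᵖa = y ∧ dᵖa for
-- some p. The iterates dᵖa decrease and d c lies below G c and H c, so the
-- axioms G x ∧ F y ≤ F (x ∧ y) and H x ∧ P y ≤ P (x ∧ y) make this relation a
-- congruence. It identifies a with 𝟙, so by simplicity it is total; that 𝟘
-- and 𝟙 agree eventually means dᵖa = 𝟘. Everything else follows: a
-- t-filter containing some x ≠ 𝟙 contains dᵖx = 𝟘, a fixed point x = d x ≠ 𝟙
-- equals dᵖx = 𝟘, and the statements about d̂ and t-ideals are the same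
-- statements in the order dual algebra, which is again a simple tDL-algebra.
module Submission where

open import Defs
open import Level using (Level)
open import Data.Nat using (ℕ; zero; _+_; _≤′_; ≤′-refl; ≤′-step) renaming (suc to sucℕ)
open import Data.Nat.Properties using (m≤′m+n; n≤′m+n)
open import Data.Product using (Σ; _×_; _,_; proj₁; proj₂; ∃-syntax)
open import Data.Sum using (_⊎_; inj₁; inj₂)
open import Data.Empty using (⊥-elim)
open import Data.Unit.Polymorphic using (tt)
open import Data.List using ([])
open import Data.List.NonEmpty using (List⁺; toList; _∷_)
open import Data.List.Relation.Unary.All using (All; []; _∷_)
open import Relation.Binary.Core using (Rel)
open import Relation.Binary.Lattice using (IsMeetSemilattice)
open import Relation.Binary.PropositionalEquality
  using (_≡_; _≢_; refl; sym; trans; cong; cong₂; subst; subst₂; module ≡-Reasoning)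
open import Relation.Unary using (Pred)
open import Relation.Nullary using (¬_; yes; no)
open import Axiom.ExcludedMiddle using (ExcludedMiddle)
open import Algebra.Core using (Op₁)
open import Algebra.Bundles using (CommutativeSemigroup)
open import Algebra.Lattice.Bundles using (DistributiveLattice)
open import Algebra.Lattice.Structures using (IsDistributiveLattice)
import Algebra.Lattice.Properties.DistributiveLattice as DistributiveLatticeProperties
import Algebra.Properties.CommutativeSemigroup as CommutativeSemigroupProperties

module Properties {ℓ : Level} (𝒜 : TDL ℓ) where
  open TDL 𝒜
  open IsDistributiveLattice isDistributiveLattice
    using (∧-comm; ∧-assoc; ∨-comm; ∨-absorbs-∧; ∧-absorbs-∨; ∧-distribʳ-∨)
  open ≡-Reasoning

  distributiveLattice : DistributiveLattice ℓ ℓ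
  distributiveLattice = record
    { Carrier = Carrier ; _≈_ = _≡_ ; _∨_ = _∨_ ; _∧_ = _∧_
    ; isDistributiveLattice = isDistributiveLattice }

  open DistributiveLatticeProperties distributiveLattice public
    using (∧-idem; ∧-∨-isDistributiveLattice)
  open DistributiveLatticeProperties distributiveLattice
    using (∧-isSemigroup; ∧-isOrderTheoreticMeetSemilattice)

  ∧-commutativeSemigroup : CommutativeSemigroup ℓ ℓ
  ∧-commutativeSemigroup = record
    { isCommutativeSemigroup = record { isSemigroup = ∧-isSemigroup ; comm = ∧-comm } }

  open CommutativeSemigroupProperties ∧-commutativeSemigroup using (xy∙z≈xz∙y)

  -- The library orders a meet semilattice by x ≡ x ∧ y, the symmetric form of _≤_.
  private module ≤ₗ = IsMeetSemilattice ∧-isOrderTheoreticMeetSemilattice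

  ≤-refl : ∀ {x} → x ≤ x
  ≤-refl = sym ≤ₗ.refl

  ≤-trans : ∀ {x y z} → x ≤ y → y ≤ z → x ≤ z
  ≤-trans x≤y y≤z = sym (≤ₗ.trans (sym x≤y) (sym y≤z))

  ≤-antisym : ∀ {x y} → x ≤ y → y ≤ x → x ≡ y
  ≤-antisym x≤y y≤x = ≤ₗ.antisym (sym x≤y) (sym y≤x)

  x∧y≤x : ∀ x y → x ∧ y ≤ x
  x∧y≤x x y = sym (≤ₗ.x∧y≤x x y)

  x∧y≤y : ∀ x y → x ∧ y ≤ y
  x∧y≤y x y = sym (≤ₗ.x∧y≤y x y)

  ∧-greatest : ∀ {x y z} → x ≤ y → x ≤ z → x ≤ y ∧ z
  ∧-greatest x≤y x≤z = sym (≤ₗ.∧-greatest (sym x≤y) (sym x≤z))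

  𝟘≤x : ∀ x → 𝟘 ≤ x
  𝟘≤x x = trans (cong (𝟘 ∧_) (sym (∨-identityˡ x))) (∧-absorbs-∨ 𝟘 x)

  x≤𝟙 : ∀ x → x ≤ 𝟙
  x≤𝟙 x = trans (∧-comm x 𝟙) (∧-identityˡ x)

  x≤y⇒y∨x≡y : ∀ {x y} → x ≤ y → y ∨ x ≡ y
  x≤y⇒y∨x≡y {x} {y} x≤y = begin
    y ∨ x       ≡⟨ cong (y ∨_) (trans (sym x≤y) (∧-comm x y)) ⟩
    y ∨ (y ∧ x) ≡⟨ ∨-absorbs-∧ y x ⟩
    y           ∎

  y∨x≡y⇒x≤y : ∀ {x y} → y ∨ x ≡ y → x ≤ y
  y∨x≡y⇒x≤y {x} {y} y∨x≡y = begin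
    x ∧ y       ≡⟨ cong (x ∧_) (trans (sym y∨x≡y) (∨-comm y x)) ⟩
    x ∧ (x ∨ y) ≡⟨ ∧-absorbs-∨ x y ⟩
    x           ∎

  ∨-homo⇒mono : (K : Op₁ Carrier) → (∀ x y → K (x ∨ y) ≡ K x ∨ K y) →
                ∀ {x y} → x ≤ y → K x ≤ K y
  ∨-homo⇒mono K K-∨ {x} {y} x≤y =
    y∨x≡y⇒x≤y (trans (sym (K-∨ y x)) (cong K (x≤y⇒y∨x≡y x≤y)))

  d≤G : ∀ x → d x ≤ G x
  d≤G x = x∧y≤x (G x) (x ∧ H x)

  d≤id : ∀ x → d x ≤ x
  d≤id x = ≤-trans (x∧y≤y (G x) (x ∧ H x)) (x∧y≤x x (H x))

  d≤H : ∀ x → d x ≤ H x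
  d≤H x = ≤-trans (x∧y≤y (G x) (x ∧ H x)) (x∧y≤y x (H x))

  d^-antitone : ∀ a {m n} → m ≤′ n → d^ n a ≤ d^ m a
  d^-antitone a ≤′-refl       = ≤-refl
  d^-antitone a (≤′-step m≤n) = ≤-trans (d≤id _) (d^-antitone a m≤n)

  AgreeBelow : Carrier → Rel Carrier ℓ
  AgreeBelow c x y = x ∧ c ≡ y ∧ c

  agreeBelow-antitone : ∀ {c e x y} → e ≤ c → AgreeBelow c x y → AgreeBelow e x y
  agreeBelow-antitone {c} {e} {x} {y} e≤c x∼y = begin
    x ∧ e       ≡⟨ cong (x ∧_) (trans (sym e≤c) (∧-comm e c)) ⟩
    x ∧ (c ∧ e) ≡⟨ sym (∧-assoc x c e) ⟩
    (x ∧ c) ∧ e ≡⟨ cong (_∧ e) x∼y ⟩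
    (y ∧ c) ∧ e ≡⟨ ∧-assoc y c e ⟩
    y ∧ (c ∧ e) ≡⟨ cong (y ∧_) (trans (∧-comm c e) e≤c) ⟩
    y ∧ e       ∎

  agreeBelow-from-≤ : ∀ {e u v} → u ∧ e ≤ v → v ∧ e ≤ u → AgreeBelow e u v
  agreeBelow-from-≤ {e} {u} {v} u∧e≤v v∧e≤u =
    ≤-antisym (∧-greatest u∧e≤v (x∧y≤y u e)) (∧-greatest v∧e≤u (x∧y≤y v e))

  agreeBelow-∧ : ∀ {c x x′ y y′} → AgreeBelow c x x′ → AgreeBelow c y y′ →
                 AgreeBelow c (x ∧ y) (x′ ∧ y′)
  agreeBelow-∧ {c} {x} {x′} {y} {y′} x∼x′ y∼y′ = begin
    (x ∧ y) ∧ c    ≡⟨ xy∙z≈xz∙y x y c ⟩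
    (x ∧ c) ∧ y    ≡⟨ cong (_∧ y) x∼x′ ⟩
    (x′ ∧ c) ∧ y   ≡⟨ sym (xy∙z≈xz∙y x′ y c) ⟩
    (x′ ∧ y) ∧ c   ≡⟨ ∧-assoc x′ y c ⟩
    x′ ∧ (y ∧ c)   ≡⟨ cong (x′ ∧_) y∼y′ ⟩
    x′ ∧ (y′ ∧ c)  ≡⟨ sym (∧-assoc x′ y′ c) ⟩
    (x′ ∧ y′) ∧ c  ∎

  agreeBelow-∨ : ∀ {c x x′ y y′} → AgreeBelow c x x′ → AgreeBelow c y y′ →
                 AgreeBelow c (x ∨ y) (x′ ∨ y′)
  agreeBelow-∨ {c} {x} {x′} {y} {y′} x∼x′ y∼y′ = begin
    (x ∨ y) ∧ c          ≡⟨ ∧-distribʳ-∨ c x y ⟩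
    (x ∧ c) ∨ (y ∧ c)    ≡⟨ cong₂ _∨_ x∼x′ y∼y′ ⟩
    (x′ ∧ c) ∨ (y′ ∧ c)  ≡⟨ sym (∧-distribʳ-∨ c x′ y′) ⟩
    (x′ ∨ y′) ∧ c        ∎

  agreeBelow-box : (K : Op₁ Carrier) → (∀ x y → K (x ∧ y) ≡ K x ∧ K y) →
                   ∀ {c e x y} → e ≤ K c → AgreeBelow c x y → AgreeBelow e (K x) (K y)
  agreeBelow-box K K-∧ {c} {e} {x} {y} e≤Kc x∼y = agreeBelow-antitone e≤Kc (begin
    K x ∧ K c  ≡⟨ sym (K-∧ x c) ⟩
    K (x ∧ c)  ≡⟨ cong K x∼y ⟩
    K (y ∧ c)  ≡⟨ K-∧ y c ⟩
    K y ∧ K c  ∎)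

  agreeBelow-diamond : (K L : Op₁ Carrier) → (∀ x y → L (x ∨ y) ≡ L x ∨ L y) →
                       (∀ x y → K x ∧ L y ≤ L (x ∧ y)) →
                       ∀ {c e x y} → e ≤ K c → AgreeBelow c x y → AgreeBelow e (L x) (L y)
  agreeBelow-diamond K L L-∨ K∧L≤L∧ {c} {e} e≤Kc x∼y =
    agreeBelow-from-≤ (below x∼y) (below (sym x∼y))
    where
    -- L x ∧ e ≤ K c ∧ L x ≤ L (c ∧ x) ≤ L y, since c ∧ x = y ∧ c ≤ y.
    below : ∀ {x y} → AgreeBelow c x y → L x ∧ e ≤ L y
    below {x} {y} x∼y = ≤-trans (∧-greatest (≤-trans (x∧y≤y (L x) e) e≤Kc) (x∧y≤x (L x) e))
      (≤-trans (K∧L≤L∧ c x)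
        (∨-homo⇒mono L L-∨ (subst (_≤ y) (trans (sym x∼y) (∧-comm x c)) (x∧y≤x y c))))

  EventuallyAgree : Carrier → Rel Carrier ℓ
  EventuallyAgree a x y = ∃[ p ] AgreeBelow (d^ p a) x y

  commonLevel : ∀ {a x x′ y y′} → EventuallyAgree a x x′ → EventuallyAgree a y y′ →
                ∃[ r ] AgreeBelow (d^ r a) x x′ × AgreeBelow (d^ r a) y y′
  commonLevel {a} (p , x∼x′) (q , y∼y′) =
    p + q , agreeBelow-antitone (d^-antitone a (m≤′m+n p q)) x∼x′
          , agreeBelow-antitone (d^-antitone a (n≤′m+n p q)) y∼y′

  eventuallyAgree-isCongruence : ∀ a → IsCongruence (EventuallyAgree a)
  eventuallyAgree-isCongruence a = record
    { isEquivalence = record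
      { refl  = 0 , refl
      ; sym   = λ (p , x∼y) → p , sym x∼y
      ; trans = λ x∼y y∼z → let r , x∼y , y∼z = commonLevel x∼y y∼z in r , trans x∼y y∼z
      }
    ; ∧-cong = λ x∼x′ y∼y′ → let r , x∼x′ , y∼y′ = commonLevel x∼x′ y∼y′ in
                 r , agreeBelow-∧ x∼x′ y∼y′
    ; ∨-cong = λ x∼x′ y∼y′ → let r , x∼x′ , y∼y′ = commonLevel x∼x′ y∼y′ in
                 r , agreeBelow-∨ x∼x′ y∼y′
    ; G-cong = λ (p , x∼y) → sucℕ p , agreeBelow-box G G∧ (d≤G _) x∼y
    ; H-cong = λ (p , x∼y) → sucℕ p , agreeBelow-box H H∧ (d≤H _) x∼y
    ; F-cong = λ (p , x∼y) → sucℕ p , agreeBelow-diamond G F F∨ G∧F (d≤G _) x∼y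
    ; P-cong = λ (p , x∼y) → sucℕ p , agreeBelow-diamond H P P∨ H∧P (d≤H _) x∼y
    }

  d^-reaches-𝟘 : IsSimple → ∀ {a} → a ≢ 𝟙 → ∃[ p ] d^ p a ≡ 𝟘
  d^-reaches-𝟘 (_ , simple) {a} a≢𝟙
    with simple (EventuallyAgree a) (eventuallyAgree-isCongruence a)
  ... | inj₁ identity =
    ⊥-elim (a≢𝟙 (identity a 𝟙 (0 , trans (∧-idem a) (sym (∧-identityˡ a)))))
  ... | inj₂ total    = let p , 𝟘∼𝟙 = total 𝟘 𝟙 in
    p , trans (sym (∧-identityˡ _)) (trans (sym 𝟘∼𝟙) (𝟘≤x _))

  module _ {Φ : Pred Carrier ℓ} (Φ-filter : IsTFilter Φ) where
    open IsTFilter Φ-filter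

    tFilter-d^ : ∀ p {x} → Φ x → Φ (d^ p x)
    tFilter-d^ zero     Φx = Φx
    tFilter-d^ (sucℕ p) Φx =
      let Φy = tFilter-d^ p Φx in ∧-closed (G-closed Φy) (∧-closed Φy (H-closed Φy))

    tFilter-trivial : ExcludedMiddle ℓ → IsSimple → (Φ ≐ Aₛ) ⊎ (Φ ≐ ｛ 𝟙 ｝)
    tFilter-trivial em simple with em {Φ 𝟘}
    ... | yes Φ𝟘 = inj₁ λ x → (λ _ → tt) , (λ _ → up-closed (𝟘≤x x) Φ𝟘)
    ... | no ¬Φ𝟘 = inj₂ λ x → Φx⇒x≡𝟙 x , (λ x≡𝟙 → subst Φ (sym x≡𝟙) has-𝟙)
      where
      Φx⇒x≡𝟙 : ∀ x → Φ x → x ≡ 𝟙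
      Φx⇒x≡𝟙 x Φx with em {x ≡ 𝟙}
      ... | yes x≡𝟙 = x≡𝟙
      ... | no x≢𝟙  = let p , d^px≡𝟘 = d^-reaches-𝟘 simple x≢𝟙 in
        ⊥-elim (¬Φ𝟘 (subst Φ d^px≡𝟘 (tFilter-d^ p Φx)))

  Aₛ-isTFilter : ∀ {Φ} → Φ ≐ Aₛ → IsTFilter Φ
  Aₛ-isTFilter {Φ} Φ≐A = record
    { has-𝟙 = all ; up-closed = λ _ _ → all ; ∧-closed = λ _ _ → all
    ; G-closed = λ _ → all ; H-closed = λ _ → all }
    where
    all : ∀ {x} → Φ x
    all {x} = proj₂ (Φ≐A x) tt

  ｛𝟙｝-isTFilter : ∀ {Φ} → Φ ≐ ｛ 𝟙 ｝ → IsTFilter Φ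
  ｛𝟙｝-isTFilter {Φ} Φ≐𝟙 = record
    { has-𝟙     = into refl
    ; up-closed = λ {x} {y} x≤y Φx →
        into (≤-antisym (x≤𝟙 y) (subst (_≤ y) (out Φx) x≤y))
    ; ∧-closed  = λ Φx Φy → into (trans (cong₂ _∧_ (out Φx) (out Φy)) (∧-idem 𝟙))
    ; G-closed  = λ Φx → into (trans (cong G (out Φx)) G1)
    ; H-closed  = λ Φx → into (trans (cong H (out Φx)) H1)
    }
    where
    out : ∀ {x} → Φ x → x ≡ 𝟙
    out {x} = proj₁ (Φ≐𝟙 x)
    into : ∀ {x} → x ≡ 𝟙 → Φ x
    into {x} = proj₂ (Φ≐𝟙 x)

  tFilter-classification : ExcludedMiddle ℓ → IsSimple → ∀ Φ →
    (IsTFilter Φ → (Φ ≐ Aₛ) ⊎ (Φ ≐ ｛ 𝟙 ｝)) × ((Φ ≐ Aₛ) ⊎ (Φ ≐ ｛ 𝟙 ｝) → IsTFilter Φ)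
  tFilter-classification em simple Φ =
    (λ Φ-filter → tFilter-trivial Φ-filter em simple) ,
    λ { (inj₁ Φ≐A) → Aₛ-isTFilter Φ≐A ; (inj₂ Φ≐𝟙) → ｛𝟙｝-isTFilter Φ≐𝟙 }

  d-fixed⇒d^-fixed : ∀ {x} → x ≡ d x → ∀ p → d^ p x ≡ x
  d-fixed⇒d^-fixed x≡dx zero     = refl
  d-fixed⇒d^-fixed x≡dx (sucℕ p) = trans (cong d (d-fixed⇒d^-fixed x≡dx p)) (sym x≡dx)

  d-fixed⇒𝟘⊎𝟙 : ExcludedMiddle ℓ → IsSimple → ∀ {x} → x ≡ d x → x ≡ 𝟘 ⊎ x ≡ 𝟙
  d-fixed⇒𝟘⊎𝟙 em simple {x} x≡dx with em {x ≡ 𝟙}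
  ... | yes x≡𝟙 = inj₂ x≡𝟙
  ... | no x≢𝟙  = let p , d^px≡𝟘 = d^-reaches-𝟘 simple x≢𝟙 in
    inj₁ (trans (sym (d-fixed⇒d^-fixed x≡dx p)) d^px≡𝟘)

  𝟘⊎𝟙⇒d-fixed : ∀ {x} → x ≡ 𝟘 ⊎ x ≡ 𝟙 → x ≡ d x
  𝟘⊎𝟙⇒d-fixed (inj₁ refl) = sym (begin
    G 𝟘 ∧ 𝟘 ∧ H 𝟘  ≡⟨ cong (G 𝟘 ∧_) (𝟘≤x (H 𝟘)) ⟩
    G 𝟘 ∧ 𝟘        ≡⟨ ∧-comm (G 𝟘) 𝟘 ⟩
    𝟘 ∧ G 𝟘        ≡⟨ 𝟘≤x (G 𝟘) ⟩
    𝟘              ∎)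
  𝟘⊎𝟙⇒d-fixed (inj₂ refl) = sym (begin
    G 𝟙 ∧ 𝟙 ∧ H 𝟙  ≡⟨ cong₂ (λ g h → g ∧ 𝟙 ∧ h) G1 H1 ⟩
    𝟙 ∧ 𝟙 ∧ 𝟙      ≡⟨ ∧-identityˡ _ ⟩
    𝟙 ∧ 𝟙          ≡⟨ ∧-identityˡ 𝟙 ⟩
    𝟙              ∎)

  inhabited : ExcludedMiddle ℓ → ∀ {X : Pred Carrier ℓ} → ¬ (X ≐ ∅ₛ) → Σ Carrier X
  inhabited em {X} X≢∅ with em {Σ Carrier X}
  ... | yes x∈X = x∈X
  ... | no ∄x∈X = ⊥-elim (X≢∅ λ x → (λ Xx → ⊥-elim (∄x∈X (x , Xx))) , λ ())

  member-≢ : ExcludedMiddle ℓ → ∀ {X : Pred Carrier ℓ} {c} → ¬ (X ≐ ∅ₛ) → ¬ (X ≐ ｛ c ｝) →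
             ∃[ u ] X u × u ≢ c
  member-≢ em {X} {c} X≢∅ X≢c with em {∃[ u ] X u × u ≢ c}
  ... | yes u = u
  ... | no ∄u = ⊥-elim (X≢c λ x → all≡c x , λ x≡c → subst X (sym x≡c) Xc)
    where
    all≡c : ∀ x → X x → x ≡ c
    all≡c x Xx with em {x ≡ c}
    ... | yes x≡c = x≡c
    ... | no x≢c  = ⊥-elim (∄u (x , Xx , x≢c))
    Xc : X c
    Xc = let w , Xw = inhabited em X≢∅ in subst X (all≡c w Xw) Xw

module Duality {ℓ : Level} (𝒜 : TDL ℓ) where
  open TDL 𝒜
  open Properties 𝒜
  open IsDistributiveLattice isDistributiveLattice using (∧-comm; ∨-comm)

  dual : TDL ℓ
  dual = record
    { Carrier = Carrier ; _∧_ = _∨_ ; _∨_ = _∧_ ; 𝟘 = 𝟙 ; 𝟙 = 𝟘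
    ; G = F ; H = P ; F = G ; P = H
    ; isDistributiveLattice = ∧-∨-isDistributiveLattice
    ; ∨-identityˡ = ∧-identityˡ ; ∧-identityˡ = ∨-identityˡ
    ; G1 = F0 ; H1 = P0 ; G∧ = F∨ ; H∧ = P∨
    ; x≤GPx = λ x → x≤y⇒y∨x≡y (FHx≤x x)
    ; x≤HFx = λ x → x≤y⇒y∨x≡y (PGx≤x x)
    ; G∨ = λ x y → x≤y⇒y∨x≡y (subst₂ _≤_ (∧-comm (G y) (F x)) (cong F (∧-comm y x)) (G∧F y x))
    ; H∨ = λ x y → x≤y⇒y∨x≡y (subst₂ _≤_ (∧-comm (H y) (P x)) (cong P (∧-comm y x)) (H∧P y x))
    ; F0 = G1 ; P0 = H1 ; F∨ = G∧ ; P∨ = H∧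
    ; PGx≤x = λ x → x≤y⇒y∨x≡y (x≤HFx x)
    ; FHx≤x = λ x → x≤y⇒y∨x≡y (x≤GPx x)
    ; G∧F = λ x y → x≤y⇒y∨x≡y (subst₂ _≤_ (cong G (∨-comm y x)) (∨-comm (G y) (F x)) (G∨ y x))
    ; H∧P = λ x y → x≤y⇒y∨x≡y (subst₂ _≤_ (cong H (∨-comm y x)) (∨-comm (H y) (P x)) (H∨ y x))
    }

  dual-congruence⇒congruence : ∀ {θ} → TDL.IsCongruence dual θ → IsCongruence θ
  dual-congruence⇒congruence θ-congruence = record
    { isEquivalence = isEquivalence
    ; ∧-cong = ∨-cong ; ∨-cong = ∧-cong
    ; G-cong = F-cong ; H-cong = P-cong ; F-cong = G-cong ; P-cong = H-cong }
    where open TDL.IsCongruence θ-congruence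

  dual-isSimple : IsSimple → TDL.IsSimple dual
  dual-isSimple (nontrivial , simple) =
    nontrivial , λ θ θ-congruence → simple θ (dual-congruence⇒congruence θ-congruence)

  d^-dual : ∀ q x → TDL.d^ dual q x ≡ d̂^ q x
  d^-dual zero     x = refl
  d^-dual (sucℕ q) x = cong d̂ (d^-dual q x)

  tIdeal⇔dual-tFilter : ∀ {Ι} → (IsTIdeal Ι → TDL.IsTFilter dual Ι) × (TDL.IsTFilter dual Ι → IsTIdeal Ι)
  tIdeal⇔dual-tFilter = (λ ideal → let open IsTIdeal ideal in record
    { has-𝟙 = has-𝟘 ; up-closed = λ y∨x≡y → down-closed (y∨x≡y⇒x≤y y∨x≡y)
    ; ∧-closed = ∨-closed ; G-closed = F-closed ; H-closed = P-closed })
    , λ filter → let open TDL.IsTFilter filter in record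
    { has-𝟘 = has-𝟙 ; down-closed = λ x≤y → up-closed (x≤y⇒y∨x≡y x≤y)
    ; ∨-closed = ∧-closed ; F-closed = G-closed ; P-closed = H-closed }

  private module Pᵒ = Properties dual

  d̂^-reaches-𝟙 : IsSimple → ∀ {a} → a ≢ 𝟘 → ∃[ q ] d̂^ q a ≡ 𝟙
  d̂^-reaches-𝟙 simple {a} a≢𝟘 =
    let q , eq = Pᵒ.d^-reaches-𝟘 (dual-isSimple simple) a≢𝟘 in q , trans (sym (d^-dual q a)) eq

  tIdeal-classification : ExcludedMiddle ℓ → IsSimple → ∀ Ι →
    (IsTIdeal Ι → (Ι ≐ Aₛ) ⊎ (Ι ≐ ｛ 𝟘 ｝)) × ((Ι ≐ Aₛ) ⊎ (Ι ≐ ｛ 𝟘 ｝) → IsTIdeal Ι)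
  tIdeal-classification em simple Ι =
    let filter⇒trivial , trivial⇒filter = Pᵒ.tFilter-classification em (dual-isSimple simple) Ι
        ideal⇒filter , filter⇒ideal = tIdeal⇔dual-tFilter
    in (λ ideal → filter⇒trivial (ideal⇒filter ideal))
     , (λ trivial → filter⇒ideal (trivial⇒filter trivial))

lemma4p19 : ∀ {ℓ : Level} → ExcludedMiddle ℓ → (𝒜 : TDL ℓ) → TDL.IsSimple 𝒜 →
    let open TDL 𝒜 in
    (∀ (X : Pred Carrier ℓ) → ¬ (X ≐ ∅ₛ) → ¬ (X ≐ ｛ 𝟘 ｝) → ¬ (X ≐ ｛ 𝟙 ｝) → ∀ (a : Carrier) →
      Σ (List⁺ Carrier) λ xs → Σ (List⁺ Carrier) λ ys → Σ ℕ λ p → Σ ℕ λ q →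
        All X (toList xs) × All X (toList ys) × (d^ p (⋀ xs) ≤ a) × (a ≤ d̂^ q (⋁ ys)))
    × (∀ (a : Carrier) → a ≢ 𝟘 → a ≢ 𝟙 →
        (Σ ℕ λ p → d^ p a ≡ 𝟘) × (Σ ℕ λ q → d̂^ q a ≡ 𝟙))
    × (∀ (Φ : Pred Carrier ℓ) → (IsTFilter Φ → (Φ ≐ Aₛ) ⊎ (Φ ≐ ｛ 𝟙 ｝)) × ((Φ ≐ Aₛ) ⊎ (Φ ≐ ｛ 𝟙 ｝) → IsTFilter Φ))
    × (∀ (Ι : Pred Carrier ℓ) → (IsTIdeal Ι → (Ι ≐ Aₛ) ⊎ (Ι ≐ ｛ 𝟘 ｝)) × ((Ι ≐ Aₛ) ⊎ (Ι ≐ ｛ 𝟘 ｝) → IsTIdeal Ι))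
    × (∀ (x : Carrier) → (x ≡ d x → x ≡ 𝟘 ⊎ x ≡ 𝟙) × (x ≡ 𝟘 ⊎ x ≡ 𝟙 → x ≡ d x))
lemma4p19 em 𝒜 simple =
    (λ X X≢∅ X≢𝟘 X≢𝟙 a →
      let u , Xu , u≢𝟙 = member-≢ em X≢∅ X≢𝟙
          v , Xv , v≢𝟘 = member-≢ em X≢∅ X≢𝟘
          p , d^pu≡𝟘 = d^-reaches-𝟘 simple u≢𝟙
          q , d̂^qv≡𝟙 = d̂^-reaches-𝟙 simple v≢𝟘
      in u ∷ [] , v ∷ [] , p , q , Xu ∷ [] , Xv ∷ [] ,
         subst (_≤ a) (sym d^pu≡𝟘) (𝟘≤x a) , subst (a ≤_) (sym d̂^qv≡𝟙) (x≤𝟙 a))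
  , (λ a a≢𝟘 a≢𝟙 → d^-reaches-𝟘 simple a≢𝟙 , d̂^-reaches-𝟙 simple a≢𝟘)
  , tFilter-classification em simple
  , tIdeal-classification em simple
  , (λ x → d-fixed⇒𝟘⊎𝟙 em simple , 𝟘⊎𝟙⇒d-fixed)
  where
  open TDL 𝒜
  open Properties 𝒜
  open Duality 𝒜
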